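{- Let $\mathcal{A}$ be a union-closed family with universe $[n]$ and length $\ell$, let $C_1=[n]\supsetneq C_2\supsetneq\cdots\supsetneq C_{\ell+1}$ be a chain in $\mathcal{A}$ of maximum size, and define $\mathcal{D}_i$ for $i\in[\ell]$ as in the context. Then for all $i\in[\ell]$, $|U(\mathcal{D}_i)|\le n-i$ and $\ell(\mathcal{D}_i)\le \ell$.
   Context: A family is a finite family of distinct finite sets; its universe is $U(\mathcal{A})=\bigcup_{A\in\mathcal{A}}A$. $\mathcal{A}$ is union-closed if $X_1,X_2\in\mathcal{A}$ implies $X_1\cup X_2\in\mathcal{A}$. A chain is a subfamily any two of whose members are comparable under inclusion; the length $\ell(\mathcal{A})$ is one less than the maximum size of a chain in $\mathcal{A}$ (so $\ell(\{\emptyset\})=0$). Note that $[n]\in\mathcal{A}$ and belongs to every maximum chain, so a maximum chain can be written $C_1=[n]\supsetneq C_2\supsetneq\cdots\supsetneq C_{\ell+1}$. With $[0]=\emptyset$, for each $i\in[\ell]$ define \[\mathcal{C}_i=\Big\{X\in\mathcal{A} : C_i\setminus C_{i+1}\subseteq X \text{ and } X\cap \textstyle\bigcup_{j\in[i-1]}(C_j\setminus C_{j+1})=\emptyset\Big\},\qquad \mathcal{D}_i=\{X\setminus (C_i\setminus C_{i+1}) : X\in\mathcal{C}_i\}.\] -}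

module Defs where

open import Data.Nat using (ℕ; suc; _≤_; _<_)
open import Data.Fin using (Fin; toℕ; inject₁) renaming (suc to fsuc)
open import Data.Fin.Subset using (Subset; _⊆_; _⊂_; _∪_; _∩_; _─_; ⋃; ⊥)
open import Data.Fin.Subset.Properties using (_⊆?_)
open import Data.Bool using (Bool)
import Data.Bool.Properties as BoolP
open import Data.Vec.Properties using (≡-dec)
open import Data.List using (List; []; _∷_; length; map; filter; allFin)
open import Data.List.Membership.Propositional using (_∈_)
open import Data.List.Relation.Unary.All using (All)
open import Data.List.Relation.Unary.AllPairs using (AllPairs)
open import Data.List.Relation.Unary.Unique.Propositional using (Unique)
open import Data.Product using (_×_; Σ; ∃)
open import Data.Sum using (_⊎_)
open import Relation.Nullary using (Dec)
open import Relation.Nullary.Decidable using (_×-dec_)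
open import Relation.Binary.PropositionalEquality using (_≡_)

Family : ℕ → Set
Family n = List (Subset n)

IsFamily : ∀ {n} → Family n → Set
IsFamily 𝒜 = Unique 𝒜

U : ∀ {n} → Family n → Subset n
U 𝒜 = ⋃ 𝒜

UnionClosed : ∀ {n} → Family n → Set
UnionClosed 𝒜 = ∀ X Y → X ∈ 𝒜 → Y ∈ 𝒜 → (X ∪ Y) ∈ 𝒜

Comparable : ∀ {n} → Subset n → Subset n → Set
Comparable X Y = X ⊆ Y ⊎ Y ⊆ X

IsChain : ∀ {n} → Family n → List (Subset n) → Set
IsChain 𝒜 𝒞 = All (_∈ 𝒜) 𝒞 × Unique 𝒞 × AllPairs Comparable 𝒞

-- ℓ(𝒜) = ℓ : max chain size is ℓ + 1
HasLength : ∀ {n} → Family n → ℕ → Set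
HasLength 𝒜 ℓ =
  (∃ λ 𝒞 → IsChain 𝒜 𝒞 × length 𝒞 ≡ suc ℓ) ×
  (∀ 𝒞 → IsChain 𝒜 𝒞 → length 𝒞 ≤ suc ℓ)

LengthAtMost : ∀ {n} → Family n → ℕ → Set
LengthAtMost 𝒜 ℓ = ∀ 𝒞 → IsChain 𝒜 𝒞 → length 𝒞 ≤ suc ℓ

_≟ˢ_ : ∀ {n} (X Y : Subset n) → Dec (X ≡ Y)
_≟ˢ_ = ≡-dec BoolP._≟_

-- Chain C_1 ⊋ ... ⊋ C_{ℓ+1} indexed 0-based: C k = C_{k+1}, k : Fin (ℓ+1).
-- For i : Fin ℓ (standing for the paper's index i+1 ∈ [ℓ]):
--   Δ C i = C_{i+1} ∖ C_{i+2} (paper: C_i ∖ C_{i+1})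
Δ : ∀ {n ℓ} → (Fin (suc ℓ) → Subset n) → Fin ℓ → Subset n
Δ C i = C (inject₁ i) ─ C (fsuc i)

Earlier : ∀ {n ℓ} → (Fin (suc ℓ) → Subset n) → Fin ℓ → Subset n
Earlier {ℓ = ℓ} C i = ⋃ (map (Δ C) (filter (λ j → toℕ j Data.Nat.<? toℕ i) (allFin ℓ)))
  where import Data.Nat

𝒞ᵢ : ∀ {n ℓ} → Family n → (Fin (suc ℓ) → Subset n) → Fin ℓ → Family n
𝒞ᵢ 𝒜 C i = filter (λ X → (Δ C i ⊆? X) ×-dec ((X ∩ Earlier C i) ≟ˢ ⊥)) 𝒜

𝒟ᵢ : ∀ {n ℓ} → Family n → (Fin (suc ℓ) → Subset n) → Fin ℓ → Family n
𝒟ᵢ 𝒜 C i = map (λ X → X ─ Δ C i) (𝒞ᵢ 𝒜 C i)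

-- An element of X ∖ Δᵢ with X ∈ 𝒞ᵢ lies in no earlier difference Δⱼ, so it survives every
-- step of the chain and lies in C_{i+1}; as |C_{i+1}| ≤ n − i for a strictly decreasing chain
-- starting at [n], this bounds U(𝒟ᵢ). For the length, Y ↦ Y ∪ Δᵢ maps 𝒟ᵢ back into 𝒜
-- (it inverts X ↦ X ∖ Δᵢ on 𝒞ᵢ, since Δᵢ ⊆ X), injectively and monotonically, so every
-- chain of 𝒟ᵢ becomes a chain of 𝒜 of the same size.
module Submission where

open import Defs
open import Data.Nat using (ℕ; suc; _≤_; _<_; _<?_; _∸_; _+_)
open import Data.Nat.Properties
  using (≤-refl; ≤-trans; +-identityʳ; +-suc; +-monoˡ-≤; m<n⇒m<1+n; m+n≤o⇒m≤o∸n; module ≤-Reasoning)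
open import Data.Fin using (Fin; toℕ; inject₁) renaming (zero to fzero; suc to fsuc)
open import Data.Fin.Properties using (toℕ-inject₁)
open import Data.Fin.Subset
  using (Subset; _⊆_; _⊃_; _∪_; _∩_; _─_; ⋃; ⊤; ⊥; ∣_∣; inside; outside)
  renaming (_∈_ to _∈ₛ_; _∉_ to _∉ₛ_)
open import Data.Fin.Subset.Properties
  using (_∈?_; _⊆?_; ∈⊤; ∉⊥; ⊆-antisym; p⊆p∪q; q⊆p∪q; x∈p∪q⁻; x∈p∩q⁺; p─q⊆p; p─q─q≡p─q;
         x∈p∧x∉q⇒x∈p─q; p⊆q⇒∣p∣≤∣q∣; p⊂q⇒∣p∣<∣q∣; ∣p∣≤n)
open import Data.Vec using ([]; _∷_; here; there)
open import Data.List using ([]; _∷_; map)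
open import Data.List.Properties using (length-map)
open import Data.List.Membership.Propositional using (_∈_)
open import Data.List.Membership.Propositional.Properties
  using (∈-map⁺; ∈-map⁻; ∈-filter⁺; ∈-filter⁻; ∈-allFin)
open import Data.List.Relation.Unary.All as All using (All; []; _∷_)
import Data.List.Relation.Unary.All.Properties as All
open import Data.List.Relation.Unary.AllPairs using (AllPairs; []; _∷_)
open import Data.List.Relation.Unary.Any using (here; there)
open import Data.Product using (_×_; ∃; _,_)
open import Data.Sum using (inj₁; inj₂)
open import Data.Empty using (⊥-elim)
open import Relation.Nullary using (yes; no)
open import Relation.Nullary.Decidable using (_×-dec_)
open import Relation.Binary.PropositionalEquality using (_≡_; refl; sym; trans; cong; subst)
open import Function using (_∘_)

private
  variable
    n : ℕ

x∈p─q⇒x∉q : ∀ {x : Fin n} (p q : Subset n) → x ∈ₛ p ─ q → x ∉ₛ q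
x∈p─q⇒x∉q (inside  ∷ p) (outside ∷ q) here       ()
x∈p─q⇒x∉q (_       ∷ p) (_       ∷ q) (there x∈) (there x∈q) = x∈p─q⇒x∉q p q x∈ x∈q

p∪q─q≡p─q : ∀ (p q : Subset n) → (p ∪ q) ─ q ≡ p ─ q
p∪q─q≡p─q []            []            = refl
p∪q─q≡p─q (_       ∷ p) (inside  ∷ q) = cong (outside ∷_) (p∪q─q≡p─q p q)
p∪q─q≡p─q (inside  ∷ p) (outside ∷ q) = cong (inside ∷_) (p∪q─q≡p─q p q)
p∪q─q≡p─q (outside ∷ p) (outside ∷ q) = cong (outside ∷_) (p∪q─q≡p─q p q)

q⊆p⇒p─q∪q≡p : ∀ {p q : Subset n} → q ⊆ p → (p ─ q) ∪ q ≡ p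
q⊆p⇒p─q∪q≡p {p = p} {q} q⊆p = ⊆-antisym ⊆p p⊆
  where
  ⊆p : (p ─ q) ∪ q ⊆ p
  ⊆p x∈ with x∈p∪q⁻ (p ─ q) q x∈
  ... | inj₁ x∈p─q = p─q⊆p p q x∈p─q
  ... | inj₂ x∈q   = q⊆p x∈q
  p⊆ : p ⊆ (p ─ q) ∪ q
  p⊆ {x} x∈p with x ∈? q
  ... | yes x∈q = q⊆p∪q (p ─ q) q x∈q
  ... | no  x∉q = p⊆p∪q q (x∈p∧x∉q⇒x∈p─q x∈p x∉q)

p⊆q⇒p∪r⊆q∪r : ∀ {p q : Subset n} (r : Subset n) → p ⊆ q → p ∪ r ⊆ q ∪ r
p⊆q⇒p∪r⊆q∪r {p = p} {q} r p⊆q x∈ with x∈p∪q⁻ p r x∈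
... | inj₁ x∈p = p⊆p∪q r (p⊆q x∈p)
... | inj₂ x∈r = q⊆p∪q q r x∈r

p∈ps⇒p⊆⋃ps : ∀ {p : Subset n} {ps} → p ∈ ps → p ⊆ ⋃ ps
p∈ps⇒p⊆⋃ps {ps = q ∷ qs} (here refl) = p⊆p∪q (⋃ qs)
p∈ps⇒p⊆⋃ps {ps = q ∷ qs} (there p∈) = q⊆p∪q q (⋃ qs) ∘ p∈ps⇒p⊆⋃ps p∈

x∈⋃⁻ : ∀ {x : Fin n} ps → x ∈ₛ ⋃ ps → ∃ λ p → p ∈ ps × x ∈ₛ p
x∈⋃⁻ []       x∈ = ⊥-elim (∉⊥ x∈)
x∈⋃⁻ (q ∷ qs) x∈ with x∈p∪q⁻ q (⋃ qs) x∈
... | inj₁ x∈q = q , here refl , x∈q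
... | inj₂ x∈⋃qs with x∈⋃⁻ qs x∈⋃qs
...   | p , p∈qs , x∈p = p , there p∈qs , x∈p

map⁺-restricted : ∀ {A B : Set} {P : A → Set} {R : A → A → Set} {S : B → B → Set} {f : A → B} →
  (∀ {x y} → P x → P y → R x y → S (f x) (f y)) →
  ∀ {xs} → All P xs → AllPairs R xs → AllPairs S (map f xs)
map⁺-restricted {P = P} {R} {S} {f} f⁺ = go
  where
  go : ∀ {xs} → All P xs → AllPairs R xs → AllPairs S (map f xs)
  go []         []         = []
  go (px ∷ pxs) (rx ∷ rxs) = All.map⁺ (All.zipWith (λ (py , r) → f⁺ px py r) (pxs , rx)) ∷ go pxs rxs

LengthAtMost-embedding : ∀ {m ℓ} {𝒜 : Family m} {𝒟 : Family n} (f : Subset n → Subset m) →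
  (∀ {Y} → Y ∈ 𝒟 → f Y ∈ 𝒜) →
  (∀ {X Y} → X ∈ 𝒟 → Y ∈ 𝒟 → f X ≡ f Y → X ≡ Y) →
  (∀ {X Y} → X ⊆ Y → f X ⊆ f Y) →
  LengthAtMost 𝒜 ℓ → LengthAtMost 𝒟 ℓ
LengthAtMost-embedding {ℓ = ℓ} f f∈ f-inj f-mono bound 𝒞 (𝒞⊆𝒟 , unique , comparable) =
  subst (_≤ suc ℓ) (length-map f 𝒞) (bound (map f 𝒞) (f𝒞⊆𝒜 , f-unique , f-comparable))
  where
  f𝒞⊆𝒜 = All.map⁺ (All.map f∈ 𝒞⊆𝒟)
  f-unique = map⁺-restricted (λ X∈ Y∈ X≢Y fX≡fY → X≢Y (f-inj X∈ Y∈ fX≡fY)) 𝒞⊆𝒟 unique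
  f-comparable = map⁺-restricted (λ where _ _ (inj₁ X⊆Y) → inj₁ (λ {x} → f-mono X⊆Y {x})
                                          _ _ (inj₂ Y⊆X) → inj₂ (λ {x} → f-mono Y⊆X {x}))
                                 𝒞⊆𝒟 comparable

StrictlyDecreasing : ∀ {ℓ} → (Fin (suc ℓ) → Subset n) → Set
StrictlyDecreasing C = ∀ i → C (inject₁ i) ⊃ C (fsuc i)

strictlyDecreasing⇒∣C∣+k≤n : ∀ {ℓ} (C : Fin (suc ℓ) → Subset n) →
  StrictlyDecreasing C → ∀ k → ∣ C k ∣ + toℕ k ≤ n
strictlyDecreasing⇒∣C∣+k≤n {n} C _ fzero = subst (_≤ n) (sym (+-identityʳ _)) (∣p∣≤n (C fzero))
strictlyDecreasing⇒∣C∣+k≤n {n} {suc ℓ} C decreasing (fsuc k) = begin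
  ∣ C (fsuc k) ∣ + suc (toℕ k)   ≡⟨ +-suc _ _ ⟩
  suc (∣ C (fsuc k) ∣ + toℕ k)   ≤⟨ +-monoˡ-≤ (toℕ k) (p⊂q⇒∣p∣<∣q∣ (decreasing k)) ⟩
  ∣ C (inject₁ k) ∣ + toℕ k      ≤⟨ strictlyDecreasing⇒∣C∣+k≤n (C ∘ inject₁) (decreasing ∘ inject₁) k ⟩
  n                              ∎
  where open ≤-Reasoning

∉earlierΔ⇒∈C : ∀ {ℓ} (C : Fin (suc ℓ) → Subset n) {x : Fin n} → x ∈ₛ C fzero →
  ∀ i → (∀ j → toℕ j < toℕ i → x ∉ₛ Δ C j) → x ∈ₛ C (inject₁ i)
∉earlierΔ⇒∈C C x∈C₀ fzero _ = x∈C₀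
∉earlierΔ⇒∈C {ℓ = suc ℓ} C {x} x∈C₀ (fsuc i) x∉Δ with x ∈? C (fsuc (inject₁ i))
... | yes x∈ = x∈
... | no  x∉ = ⊥-elim (x∉Δ (inject₁ i) i′<1+i (x∈p∧x∉q⇒x∈p─q x∈Cᵢ x∉))
  where
  i′<1+i : toℕ (inject₁ i) < suc (toℕ i)
  i′<1+i = subst (_< suc (toℕ i)) (sym (toℕ-inject₁ i)) ≤-refl
  x∈Cᵢ : x ∈ₛ C (inject₁ (inject₁ i))
  x∈Cᵢ = ∉earlierΔ⇒∈C (C ∘ inject₁) x∈C₀ i λ j j<i →
    x∉Δ (inject₁ j) (subst (_< suc (toℕ i)) (sym (toℕ-inject₁ j)) (m<n⇒m<1+n j<i))

Δ⊆Earlier : ∀ {ℓ} (C : Fin (suc ℓ) → Subset n) {i j : Fin ℓ} →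
  toℕ j < toℕ i → Δ C j ⊆ Earlier C i
Δ⊆Earlier C {i} {j} j<i =
  p∈ps⇒p⊆⋃ps (∈-map⁺ (Δ C) (∈-filter⁺ (λ k → toℕ k <? toℕ i) (∈-allFin j) j<i))

module _ {ℓ} (𝒜 : Family n) (C : Fin (suc ℓ) → Subset n) (i : Fin ℓ) where

  ∈-𝒟ᵢ⁻ : ∀ {Y} → Y ∈ 𝒟ᵢ 𝒜 C i →
    ∃ λ X → X ∈ 𝒜 × Δ C i ⊆ X × X ∩ Earlier C i ≡ ⊥ × Y ≡ X ─ Δ C i
  ∈-𝒟ᵢ⁻ Y∈ with ∈-map⁻ (_─ Δ C i) Y∈
  ... | X , X∈𝒞ᵢ , Y≡ with ∈-filter⁻ (λ X → (Δ C i ⊆? X) ×-dec ((X ∩ Earlier C i) ≟ˢ ⊥)) {xs = 𝒜} X∈𝒞ᵢ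
  ...   | X∈𝒜 , Δ⊆X , disjoint = X , X∈𝒜 , Δ⊆X , disjoint , Y≡

  U𝒟ᵢ⊆C : C fzero ≡ ⊤ → U (𝒟ᵢ 𝒜 C i) ⊆ C (fsuc i)
  U𝒟ᵢ⊆C C₀≡⊤ {x} x∈U with x∈⋃⁻ (𝒟ᵢ 𝒜 C i) x∈U
  ... | Y , Y∈ , x∈Y with ∈-𝒟ᵢ⁻ Y∈
  ...   | X , _ , _ , disjoint , refl = x∈Cᵢ₊₁
    where
    x∈X : x ∈ₛ X
    x∈X = p─q⊆p X (Δ C i) x∈Y
    x∉earlierΔ : ∀ j → toℕ j < toℕ i → x ∉ₛ Δ C j
    x∉earlierΔ j j<i x∈Δⱼ = ∉⊥ (subst (x ∈ₛ_) disjoint (x∈p∩q⁺ (x∈X , Δ⊆Earlier C j<i x∈Δⱼ)))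
    x∈Cᵢ : x ∈ₛ C (inject₁ i)
    x∈Cᵢ = ∉earlierΔ⇒∈C C (subst (x ∈ₛ_) (sym C₀≡⊤) ∈⊤) i x∉earlierΔ
    x∈Cᵢ₊₁ : x ∈ₛ C (fsuc i)
    x∈Cᵢ₊₁ with x ∈? C (fsuc i)
    ... | yes x∈ = x∈
    ... | no  x∉ = ⊥-elim (x∈p─q⇒x∉q X (Δ C i) x∈Y (x∈p∧x∉q⇒x∈p─q x∈Cᵢ x∉))

  ∪Δ∈𝒜 : ∀ {Y} → Y ∈ 𝒟ᵢ 𝒜 C i → Y ∪ Δ C i ∈ 𝒜
  ∪Δ∈𝒜 Y∈ with ∈-𝒟ᵢ⁻ Y∈
  ... | X , X∈𝒜 , Δ⊆X , _ , refl = subst (_∈ 𝒜) (sym (q⊆p⇒p─q∪q≡p Δ⊆X)) X∈𝒜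

  ∪Δ─Δ≡id : ∀ {Y} → Y ∈ 𝒟ᵢ 𝒜 C i → (Y ∪ Δ C i) ─ Δ C i ≡ Y
  ∪Δ─Δ≡id Y∈ with ∈-𝒟ᵢ⁻ Y∈
  ... | X , _ , _ , _ , refl = trans (p∪q─q≡p─q (X ─ Δ C i) (Δ C i)) (p─q─q≡p─q X (Δ C i))

  ∪Δ-injective : ∀ {X Y} → X ∈ 𝒟ᵢ 𝒜 C i → Y ∈ 𝒟ᵢ 𝒜 C i →
    X ∪ Δ C i ≡ Y ∪ Δ C i → X ≡ Y
  ∪Δ-injective X∈ Y∈ eq = trans (sym (∪Δ─Δ≡id X∈)) (trans (cong (_─ Δ C i) eq) (∪Δ─Δ≡id Y∈))

lemma3p3 : ∀ (n ℓ : ℕ) (𝒜 : Family n) →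
    IsFamily 𝒜 → UnionClosed 𝒜 → U 𝒜 ≡ ⊤ → HasLength 𝒜 ℓ →
    (C : Fin (suc ℓ) → Subset n) →
    (∀ k → C k ∈ 𝒜) → C Data.Fin.zero ≡ ⊤ →
    (∀ (i : Fin ℓ) → C (inject₁ i) ⊃ C (fsuc i)) →
    ∀ (i : Fin ℓ) →
    ∣ U (𝒟ᵢ 𝒜 C i) ∣ ≤ n ∸ suc (toℕ i) × LengthAtMost (𝒟ᵢ 𝒜 C i) ℓ
lemma3p3 n ℓ 𝒜 _ _ _ (_ , maxChain) C _ C₀≡⊤ strict i =
  ≤-trans (p⊆q⇒∣p∣≤∣q∣ (U𝒟ᵢ⊆C 𝒜 C i C₀≡⊤))
          (m+n≤o⇒m≤o∸n _ (strictlyDecreasing⇒∣C∣+k≤n C strict (fsuc i))) ,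
  LengthAtMost-embedding (_∪ Δ C i) (∪Δ∈𝒜 𝒜 C i) (∪Δ-injective 𝒜 C i)
                         (p⊆q⇒p∪r⊆q∪r (Δ C i)) maxChain
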